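{- Let $\Omega$ be a set and let $d:\Omega\times\Omega\to\mathbb{R}_+$ be a co-weightable quasi-metric on $\Omega$ with weight function $w:\Omega\to\mathbb{R}$. Let $\rho$ be the metric symmetrising $d$, given by $\rho(x,y)=\frac12\big(d(x,y)+d(y,x)\big)$ for all $x,y\in\Omega$. For $x\in\Omega$ and $\varepsilon>0$ let $\mathfrak{B}(x,\varepsilon)=\{y\in\Omega: d(x,y)\le\varepsilon\}$ and $\mathfrak{D}(x,\varepsilon)=\{y\in\Omega:\rho(x,y)\le\varepsilon\}$. For $x\in\Omega$ and $z\in\mathbb{R}$ let $\delta(x,z)=\frac12\big(z-w(x)\big)$, and for $z\in w(\Omega)$ let $\Omega(z)=\{y\in\Omega: w(y)=z\}$. Then for all $x\in\Omega$ and $\varepsilon>0$, \[\mathfrak{B}(x,\varepsilon)=\bigsqcup_{z\in w(\Omega)}\Big(\mathfrak{D}\big(x,\varepsilon+\delta(x,z)\big)\cap\Omega(z)\Big),\] where $\bigsqcup$ denotes a (pairwise disjoint) union.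
   Context: A quasi-metric on a set $\Omega$ is a map $d:\Omega\times\Omega\to\mathbb{R}_+$ such that (i) for all $x,y\in\Omega$, $d(x,y)=d(y,x)=0$ if and only if $x=y$, and (ii) $d(x,z)\le d(x,y)+d(y,z)$ for all $x,y,z\in\Omega$. A quasi-metric $d$ is co-weightable with weight function $w:\Omega\to\mathbb{R}$ if $d(x,y)+w(y)=d(y,x)+w(x)$ for all $x,y\in\Omega$. The sets $\Omega(z)$, $z\in w(\Omega)$, are called fibres. (The paper writes the restriction of a set $A$ to a fibre as $A\vert\Omega(z)$, meaning $A\cap\Omega(z)$.) -}

module Defs where

open import Level using (0ℓ)
open import Data.Product using (Σ; ∃; _×_; _,_)
open import Relation.Nullary using (¬_)
open import Relation.Binary.PropositionalEquality using (_≡_)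
open import Relation.Binary.Structures using (IsTotalOrder)
open import Algebra.Structures using (IsCommutativeRing)

-- An abstract model of the real numbers: a complete (Dedekind / least upper
-- bound) totally ordered field, with propositional equality as equality.
-- Any two such structures are isomorphic, so quantifying over them is the
-- same as working with ℝ.
record RealField : Set₁ where
  infixl 6 _+_
  infixl 7 _*_
  infix 8 -_
  infix 9 _⁻¹
  infix 4 _≤_ _<_
  field
    ℝ   : Set
    0# 1# : ℝ
    _+_ _*_ : ℝ → ℝ → ℝ
    -_  : ℝ → ℝ
    _⁻¹ : ℝ → ℝ            -- value at 0 is irrelevant
    _≤_ : ℝ → ℝ → Set
    isCommutativeRing : IsCommutativeRing _≡_ _+_ _*_ -_ 0# 1#
    0≢1 : ¬ (0# ≡ 1#)
    ⁻¹-inverse : ∀ x → ¬ (x ≡ 0#) → x * x ⁻¹ ≡ 1#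
    ≤-isTotalOrder : IsTotalOrder _≡_ _≤_
    +-monoˡ-≤ : ∀ {x y} z → x ≤ y → x + z ≤ y + z
    *-nonneg  : ∀ {x y} → 0# ≤ x → 0# ≤ y → 0# ≤ x * y
    sup : (P : ℝ → Set) → Σ ℝ P → Σ ℝ (λ b → ∀ x → P x → x ≤ b) →
          Σ ℝ (λ s → (∀ x → P x → x ≤ s) × (∀ b → (∀ x → P x → x ≤ b) → s ≤ b))

  _<_ : ℝ → ℝ → Set
  x < y = (x ≤ y) × ¬ (x ≡ y)

  _-_ : ℝ → ℝ → ℝ
  x - y = x + (- y)

  ½ : ℝ
  ½ = (1# + 1#) ⁻¹

module Spaces (R : RealField) where
  open RealField R

  record IsQuasiMetric {Ω : Set} (d : Ω → Ω → ℝ) : Set where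
    field
      nonneg : ∀ x y → 0# ≤ d x y
      sep    : ∀ x y → (d x y ≡ 0# × d y x ≡ 0#) → x ≡ y
      refl0  : ∀ x → d x x ≡ 0#
      triangle : ∀ x y z → d x z ≤ d x y + d y z

  IsCoWeightable : {Ω : Set} → (Ω → Ω → ℝ) → (Ω → ℝ) → Set
  IsCoWeightable {Ω} d w = ∀ (x y : Ω) → d x y + w y ≡ d y x + w x

  module _ {Ω : Set} (d : Ω → Ω → ℝ) (w : Ω → ℝ) where
    ρ : Ω → Ω → ℝ
    ρ x y = ½ * (d x y + d y x)

    𝔅 : Ω → ℝ → Ω → Set
    𝔅 x ε y = d x y ≤ ε

    𝔇 : Ω → ℝ → Ω → Set
    𝔇 x ε y = ρ x y ≤ ε

    δ : Ω → ℝ → ℝ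
    δ x z = ½ * (z - w x)

    InImage : ℝ → Set
    InImage z = ∃ λ u → w u ≡ z

    Fibre : ℝ → Ω → Set
    Fibre z y = w y ≡ z

    Piece : Ω → ℝ → ℝ → Ω → Set
    Piece x ε z y = 𝔇 x (ε + δ x z) y × Fibre z y

{-# OPTIONS --safe #-}
-- Co-weightability says d(y,x) = d(x,y) + (w(y) − w(x)), so ρ(x,y) = d(x,y) + δ(x,w(y)).
-- Hence d(x,y) ≤ ε iff ρ(x,y) ≤ ε + δ(x,w(y)), i.e. iff y lies in the piece over its own
-- fibre w(y); the pieces are disjoint because the fibres are.
module Submission where

open import Defs
open import Data.Product using (Σ; _×_; _,_)
open import Data.Sum using (inj₁; inj₂)
open import Relation.Nullary using (¬_)
open import Relation.Binary.PropositionalEquality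
  using (_≡_; refl; sym; trans; cong; subst; subst₂; module ≡-Reasoning)
open import Relation.Binary.Structures using (IsTotalOrder)
open import Algebra.Bundles using (CommutativeRing)
open import Function.Bundles using (_⇔_; mk⇔)
open import Function.Properties.Equivalence using () renaming (trans to ⇔-trans)

module RealFieldProperties (R : RealField) where
  open RealField R

  commutativeRing : CommutativeRing _ _
  commutativeRing = record { isCommutativeRing = isCommutativeRing }

  open CommutativeRing commutativeRing
    using (*-comm; *-identityˡ; +-identityˡ; -‿inverseʳ; ring; commutativeSemiring)
  open import Algebra.Properties.Ring ring using (-1*x≈-x; -‿involutive; //-rightDividesʳ)
  open import Algebra.Solver.Ring.NaturalCoefficients.Default commutativeSemiring
  open IsTotalOrder ≤-isTotalOrder using (antisym; total)

  +-cancelʳ-≤ : ∀ {x y} z → x + z ≤ y + z → x ≤ y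
  +-cancelʳ-≤ {x} {y} z x+z≤y+z =
    subst₂ _≤_ (//-rightDividesʳ z x) (//-rightDividesʳ z y) (+-monoˡ-≤ (- z) x+z≤y+z)

  -1*-1≡1 : - 1# * - 1# ≡ 1#
  -1*-1≡1 = trans (-1*x≈-x (- 1#)) (-‿involutive 1#)

  0≤1 : 0# ≤ 1#
  0≤1 with total 0# 1#
  ... | inj₁ 0≤1 = 0≤1
  ... | inj₂ 1≤0 = subst (0# ≤_) -1*-1≡1 (*-nonneg 0≤-1 0≤-1)
    where
      0≤-1 : 0# ≤ - 1#
      0≤-1 = subst₂ _≤_ (-‿inverseʳ 1#) (+-identityˡ (- 1#)) (+-monoˡ-≤ (- 1#) 1≤0)

  1+1≢0 : ¬ (1# + 1# ≡ 0#)
  1+1≢0 1+1≡0 = 0≢1 (antisym 0≤1 (subst₂ _≤_ (+-identityˡ 1#) 1+1≡0 (+-monoˡ-≤ 1# 0≤1)))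

  ½*[1+1]≡1 : ½ * (1# + 1#) ≡ 1#
  ½*[1+1]≡1 = trans (*-comm ½ (1# + 1#)) (⁻¹-inverse (1# + 1#) 1+1≢0)

  ½*[x+[x+y]]≡x+½*y : ∀ x y → ½ * (x + (x + y)) ≡ x + ½ * y
  ½*[x+[x+y]]≡x+½*y x y = begin
    ½ * (x + (x + y))         ≡⟨ distribute ½ x y ⟩
    ½ * (1# + 1#) * x + ½ * y ≡⟨ cong (λ t → t * x + ½ * y) ½*[1+1]≡1 ⟩
    1# * x + ½ * y            ≡⟨ cong (_+ ½ * y) (*-identityˡ x) ⟩
    x + ½ * y                 ∎
    where
      open ≡-Reasoning
      distribute : ∀ h x y → h * (x + (x + y)) ≡ h * (1# + 1#) * x + h * y
      distribute = solve 3 (λ h x y → h :* (x :+ (x :+ y)) := h :* (con 1 :+ con 1) :* x :+ h :* y) refl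

module CoWeightable (R : RealField) where
  open RealField R
  open Spaces R
  open RealFieldProperties R
  open CommutativeRing commutativeRing using (+-assoc; ring)
  open import Algebra.Properties.Ring ring using (//-rightDividesʳ)

  module _ {Ω : Set} {d : Ω → Ω → ℝ} {w : Ω → ℝ} (coweight : IsCoWeightable d w) where

    d-flip : ∀ x y → d y x ≡ d x y + (w y - w x)
    d-flip x y = begin
      d y x                 ≡⟨ sym (//-rightDividesʳ (w x) (d y x)) ⟩
      (d y x + w x) - w x   ≡⟨ cong (_- w x) (sym (coweight x y)) ⟩
      (d x y + w y) - w x   ≡⟨ +-assoc (d x y) (w y) (- w x) ⟩
      d x y + (w y - w x)   ∎
      where open ≡-Reasoning

    ρ≡d+δ : ∀ x y → ρ d w x y ≡ d x y + δ d w x (w y)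
    ρ≡d+δ x y = trans (cong (λ t → ½ * (d x y + t)) (d-flip x y))
                      (½*[x+[x+y]]≡x+½*y (d x y) (w y - w x))

    𝔅⇔𝔇-δ : ∀ x ε y → 𝔅 d w x ε y ⇔ 𝔇 d w x (ε + δ d w x (w y)) y
    𝔅⇔𝔇-δ x ε y = mk⇔
      (λ dxy≤ε → subst (_≤ ε + δₓ) (sym (ρ≡d+δ x y)) (+-monoˡ-≤ δₓ dxy≤ε))
      (λ ρxy≤ → +-cancelʳ-≤ δₓ (subst (_≤ ε + δₓ) (ρ≡d+δ x y) ρxy≤))
      where δₓ = δ d w x (w y)

  module _ {Ω : Set} (d : Ω → Ω → ℝ) (w : Ω → ℝ) where

    Σ-fibre⇔ : (P : ℝ → Ω → Set) (y : Ω) →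
                P (w y) y ⇔ (Σ ℝ λ z → InImage d w z × P z y × Fibre d w z y)
    Σ-fibre⇔ P y = mk⇔ (λ p → w y , (y , refl) , p , refl) λ { (_ , _ , p , refl) → p }

    Fibre-disjoint : ∀ {z z′} → ¬ (z ≡ z′) → (y : Ω) → ¬ (Fibre d w z y × Fibre d w z′ y)
    Fibre-disjoint z≢z′ y (wy≡z , wy≡z′) = z≢z′ (trans (sym wy≡z) wy≡z′)

lemma1 : (R : RealField) → let open RealField R in let open Spaces R in
    {Ω : Set} (d : Ω → Ω → ℝ) (w : Ω → ℝ) →
    IsQuasiMetric d → IsCoWeightable d w →
    (x : Ω) (ε : ℝ) → 0# < ε →
    ((y : Ω) → 𝔅 d w x ε y ⇔ (Σ ℝ λ z → InImage d w z × Piece d w x ε z y))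
    × ((z z′ : ℝ) → InImage d w z → InImage d w z′ → ¬ (z ≡ z′) →
       (y : Ω) → ¬ (Piece d w x ε z y × Piece d w x ε z′ y))
lemma1 R d w _ coweight x ε _ =
    (λ y → ⇔-trans (𝔅⇔𝔇-δ coweight x ε y) (Σ-fibre⇔ d w (λ z → 𝔇 d w x (ε + δ d w x z)) y))
  , λ z z′ _ _ z≢z′ y ((_ , y∈Ωz) , (_ , y∈Ωz′)) → Fibre-disjoint d w z≢z′ y (y∈Ωz , y∈Ωz′)
  where
    open RealField R using (_+_)
    open Spaces R
    open CoWeightable R
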